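{- Let $L$ be a finite ranked lattice with rank function $\rho$ and let $(A_1,\dots,A_n)$ be an ordered partition of the atom set of $L$. Let $P=\prod_{i=1}^n CL_{A_i}$ and let $\sim$ be the standard equivalence relation on $P$. Suppose that (1) for all $x\in L$, $\mathcal{T}_x^A\neq\emptyset$; and (2) for all $x\in L$ and all $\mathbf{t}\in\mathcal{T}_x^A$, $|\operatorname{supp}\mathbf{t}|=\rho(x)$. Then: (a) for every $x\in L$, the lower order ideal of $P$ generated by $\mathcal{T}_x^A$ is $L(\mathcal{T}_x^A)=\{\mathbf{t}\in P : t_i\leq x \text{ in } L \text{ for all } i\}$; (b) the quotient $P/\sim$ is homogeneous; (c) the condition $\sum_{\mathbf{y}\in L(\mathcal{T}_x^A)}\mu(\mathbf{y})=0$ (with $\mu$ the Möbius function of $P$) holds for every $x\in L$ with $x\neq\hat{0}$ if and only if for each $x\in L$ with $x\neq\hat{0}$ there is an index $i$ with $|A_i\cap A_x|=1$.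
   Context: For a set $A$ of atoms of $L$, the claw $CL_A$ is the poset consisting of a minimum element labelled $\hat{0}_L$ together with the elements of $A$ as pairwise incomparable atoms, and nothing else. The product $\prod_{i=1}^n CL_{A_i}$ carries the componentwise order; its elements $\mathbf{t}=(t_1,\dots,t_n)$ (with $t_i\in A_i\cup\{\hat{0}\}$) are called atomic transversals. $\operatorname{supp}\mathbf{t}$ is the set of indices $i$ with $t_i\neq\hat{0}$, and $\bigvee\mathbf{t}=t_1\vee\dots\vee t_n$ (join in $L$). The standard equivalence relation is $\mathbf{s}\sim\mathbf{t}$ iff $\bigvee\mathbf{s}=\bigvee\mathbf{t}$ in $L$. For $x\in L$, $\mathcal{T}_x^A=\{\mathbf{t}\in\prod_i CL_{A_i}:\bigvee\mathbf{t}=x\}$. $A_x$ denotes the set of atoms of $L$ below $x$. For an equivalence relation on a poset $Q$, the quotient $Q/\sim$ is the set of classes with $X\leq Y$ iff $x\leq y$ for some $x\in X$, $y\in Y$; it is homogeneous if the class of $\hat{0}$ is a singleton and whenever $X\leq Y$, for every $x\in X$ there is $y\in Y$ with $x\leq y$. The Möbius function of a poset with minimum $\hat{0}$ is defined by $\sum_{y\leq x}\mu(y)=\delta_{\hat{0},x}$. -}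

module Defs where

open import Data.Nat using (ℕ; zero; suc)
open import Data.Fin using (Fin; zero; suc)
import Data.Fin as Fin
open import Data.Fin.Properties using (all?)
open import Data.Integer using (ℤ; 0ℤ; 1ℤ; _+_)
open import Data.List using (List; []; _∷_; [_]; map; concatMap; filter; foldr)
open import Data.List.Membership.Propositional using (_∈_)
open import Data.List.Relation.Unary.Unique.Propositional using (Unique)
open import Data.List.Relation.Unary.Any using (Any; any?)
import Data.List.Relation.Unary.All as All
open import Data.Product using (Σ; _×_; _,_)
open import Data.Sum using (_⊎_)
open import Relation.Binary.PropositionalEquality using (_≡_; _≢_)
open import Relation.Binary.Definitions using (Decidable; DecidableEquality)
open import Relation.Binary.Lattice.Structures using (IsLattice)
open import Relation.Nullary using (Dec; yes; no; ¬?)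
open import Relation.Nullary.Decidable using (_×-dec_; _⊎-dec_; _→-dec_)

-- Order and equality are decidable (as is automatic
-- for a finite poset given classically); finiteness is witnessed by a
-- duplicate-free list `elems` containing every element.
record FiniteRankedLattice : Set₁ where
  field
    Carrier     : Set
    _≤_         : Carrier → Carrier → Set
    _∨_         : Carrier → Carrier → Carrier
    _∧_         : Carrier → Carrier → Carrier
    isLattice   : IsLattice _≡_ _≤_ _∨_ _∧_
    _≟_         : DecidableEquality Carrier
    _≤?_        : Decidable _≤_
    elems       : List Carrier
    elems-all   : ∀ x → x ∈ elems
    elems-uniq  : Unique elems
    𝟘           : Carrier
    𝟘-min       : ∀ x → 𝟘 ≤ x

  _⋖_ : Carrier → Carrier → Set
  x ⋖ y = x ≤ y × x ≢ y × (∀ z → x ≤ z → z ≤ y → z ≡ x ⊎ z ≡ y)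

  field
    ρ       : Carrier → ℕ
    ρ-𝟘     : ρ 𝟘 ≡ 0
    ρ-cover : ∀ x y → x ⋖ y → ρ y ≡ suc (ρ x)

  IsAtom : Carrier → Set
  IsAtom a = 𝟘 ⋖ a

  ∀?-elems : {P : Carrier → Set} → (∀ z → Dec (P z)) → Dec (∀ z → P z)
  ∀?-elems P? with All.all? P? elems
  ... | yes h = yes (λ z → All.lookup h (elems-all z))
  ... | no ¬h = no (λ h → ¬h (All.tabulate (λ {z} _ → h z)))

  atom? : ∀ a → Dec (IsAtom a)
  atom? a = (𝟘 ≤? a) ×-dec (¬? (𝟘 ≟ a)) ×-dec
            ∀?-elems (λ z → (𝟘 ≤? z) →-dec ((z ≤? a) →-dec ((z ≟ 𝟘) ⊎-dec (z ≟ a))))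

-- Setting: L, a number n of blocks, and blk a = i  meaning  a ∈ A_i
-- (the value of blk on non-atoms is irrelevant).
module Setup (L : FiniteRankedLattice) (n : ℕ) (blk : FiniteRankedLattice.Carrier L → Fin n) where
  open FiniteRankedLattice L public

  -- (A_1,…,A_n) is an ordered partition of the atom set: each block nonempty
  -- (disjointness and covering are automatic from blk being a function on atoms).
  IsOrderedPartition : Set
  IsOrderedPartition = ∀ i → Σ Carrier λ a → IsAtom a × blk a ≡ i

  -- Elements of P = ∏ CL_{A_i}: functions t : Fin n → L with t i ∈ A_i ∪ {0̂}.
  IsTransversal : (Fin n → Carrier) → Set
  IsTransversal t = ∀ i → t i ≡ 𝟘 ⊎ (IsAtom (t i) × blk (t i) ≡ i)

  transversal? : ∀ t → Dec (IsTransversal t)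
  transversal? t = all? (λ i → (t i ≟ 𝟘) ⊎-dec (atom? (t i) ×-dec (blk (t i) Fin.≟ i)))

  P : Set
  P = Σ (Fin n → Carrier) IsTransversal

  -- componentwise order of the product of claws (in CL_{A_i}: s ≤ t iff s = 0̂ or s = t)
  _≤P_ : (Fin n → Carrier) → (Fin n → Carrier) → Set
  s ≤P t = ∀ i → s i ≡ 𝟘 ⊎ s i ≡ t i

  ≤P? : ∀ s t → Dec (s ≤P t)
  ≤P? s t = all? (λ i → (s i ≟ 𝟘) ⊎-dec (s i ≟ t i))

  𝟘P : Fin n → Carrier
  𝟘P _ = 𝟘

  bigJoin : ∀ {k} → (Fin k → Carrier) → Carrier
  bigJoin {zero}  t = 𝟘
  bigJoin {suc k} t = t zero ∨ bigJoin (λ i → t (suc i))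

  _∼_ : (Fin n → Carrier) → (Fin n → Carrier) → Set
  s ∼ t = bigJoin s ≡ bigJoin t

  suppSize : (Fin n → Carrier) → ℕ
  suppSize t = Data.List.length (filter (λ i → ¬? (t i ≟ 𝟘)) (Data.List.allFin n))

  funs : ∀ k → List (Fin k → Carrier)
  funs zero    = [ (λ ()) ]
  funs (suc k) = concatMap (λ c → map (λ f → λ { zero → c ; (suc i) → f i }) (funs k)) elems

  Pelems : List (Fin n → Carrier)
  Pelems = filter transversal? (funs n)

  sumℤ : List ℤ → ℤ
  sumℤ = foldr _+_ 0ℤ

  ΣP : {Q : (Fin n → Carrier) → Set} → (∀ t → Dec (Q t)) → ((Fin n → Carrier) → ℤ) → ℤ
  ΣP Q? f = sumℤ (map f (filter Q? Pelems))

  δ𝟘 : (Fin n → Carrier) → ℤ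
  δ𝟘 t with all? (λ i → t i ≟ 𝟘)
  ... | yes _ = 1ℤ
  ... | no  _ = 0ℤ

  IsMobius : ((Fin n → Carrier) → ℤ) → Set
  IsMobius μ = ∀ (t : P) → ΣP (λ s → ≤P? s (Data.Product.proj₁ t)) μ ≡ δ𝟘 (Data.Product.proj₁ t)

  InIdeal : Carrier → (Fin n → Carrier) → Set
  InIdeal x s = Any (λ t → bigJoin t ≡ x × s ≤P t) Pelems

  InIdeal? : ∀ x s → Dec (InIdeal x s)
  InIdeal? x s = any? (λ t → (bigJoin t ≟ x) ×-dec ≤P? s t) Pelems

  OneAtomBelow : Fin n → Carrier → Set
  OneAtomBelow i x =
    Σ Carrier λ a → (IsAtom a × blk a ≡ i × a ≤ x) ×
      (∀ b → IsAtom b → blk b ≡ i → b ≤ x → b ≡ a)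

module Submission where

open import Defs
open import Algebra.Bundles using (AbelianGroup)
import Algebra.Properties.CommutativeSemigroup as CommSemigroupProps
import Algebra.Properties.Group as GroupProps
open import Data.Fin using (Fin; zero; suc)
import Data.Fin as Fin
open import Data.Fin.Properties using (¬∀⟶∃¬; all?)
open import Data.Integer using (ℤ; 0ℤ; 1ℤ; +_; _+_; _*_; _-_)
import Data.Integer.Properties as ℤ
open import Data.List using (List; []; _∷_; map; filter; foldr; concatMap; _++_; length; allFin)
open import Data.List.Membership.Propositional using (_∈_; lose; find)
open import Data.List.Membership.Propositional.Properties using (∈-filter⁺; ∈-filter⁻)
open import Data.List.Properties using (filter-some)
open import Data.List.Relation.Binary.Pointwise using (Pointwise-≡⇒≡)
open import Data.List.Relation.Binary.Sublist.Heterogeneous.Properties using (length-mono-≤; ⊆-filter-Sublist; toPointwise)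
open import Data.List.Relation.Binary.Sublist.Propositional using (_⊆_; ⊆-refl)
import Data.List.Relation.Unary.All as All
open import Data.List.Relation.Unary.AllPairs using (_∷_)
open import Data.List.Relation.Unary.Any using (Any; here; there; any?; satisfied)
import Data.List.Relation.Unary.Any as Any
open import Data.List.Relation.Unary.Any.Properties using (concatMap⁺; map⁺)
open import Data.List.Relation.Unary.Unique.Propositional using (Unique)
open import Data.Nat using (ℕ; zero; suc)
import Data.Nat as ℕ
import Data.Nat.Properties as ℕ
open import Data.Product using (Σ; ∃; _×_; _,_; proj₁; proj₂)
open import Data.Sum using (_⊎_; inj₁; inj₂; [_,_]′)
import Data.Sum as Sum
open import Function.Base using (_∘_)
open import Function.Bundles using (_⇔_; mk⇔; Equivalence)
open import Relation.Binary.Definitions using (DecidableEquality)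
open import Relation.Binary.Lattice.Structures using (IsLattice)
open import Relation.Binary.PropositionalEquality
open import Relation.Nullary using (Dec; yes; no; ¬_; ¬?; contradiction)
open import Relation.Nullary.Decidable using (_×-dec_; _⊎-dec_)
open import Relation.Unary using (Pred; Decidable)
open import Algebra.Properties.CommutativeMonoid.Sum ℤ.*-1-commutativeMonoid
  using () renaming (sum to ∏; sum-cong-≗ to ∏-cong; ∑-distrib-+ to ∏-distrib-*)

-- (a) Given s ∈ P with all sᵢ ≤ x, fill the zero coordinates of s from some t ∈ T_x.  The result r
-- has ⋁r ≤ x and at least ρ(x) nonzero coordinates, so hypothesis (2) gives ρ(⋁r) ≥ ρ(x), whence
-- ⋁r = x and s ≤ r ∈ T_x.  (b) follows from (a) applied to x = ⋁t.
-- (c) Put wᵢ(0̂) = 1 − kᵢ and wᵢ(a) = 1 on atoms, where kᵢ = |Aᵢ ∩ A_x|, and let W(t) = ∏ᵢ wᵢ(tᵢ) on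
-- L(T_x), which by (a) is the product of the claws on {0̂} ∪ (Aᵢ ∩ A_x).  Coordinatewise,
-- Σ_{t ≥ s} W(t) = 1 for every s ∈ L(T_x), so exchanging the order of summation
--   Σ_{s ∈ L(T_x)} μ(s) = Σ_{t ∈ L(T_x)} W(t) Σ_{s ≤ t} μ(s) = W(0̂) = ∏ᵢ (1 − kᵢ),
-- which vanishes exactly when some kᵢ = 1.

𝟙 : ∀ {p} {P : Set p} → Dec P → ℤ
𝟙 (yes _) = 1ℤ
𝟙 (no _)  = 0ℤ

𝟙-yes : ∀ {p} {P : Set p} (d : Dec P) → P → 𝟙 d ≡ 1ℤ
𝟙-yes (yes _) _ = refl
𝟙-yes (no ¬p) p = contradiction p ¬p

𝟙-no : ∀ {p} {P : Set p} (d : Dec P) → ¬ P → 𝟙 d ≡ 0ℤ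
𝟙-no (yes p) ¬p = contradiction p ¬p
𝟙-no (no _)  _  = refl

𝟙-cong : ∀ {p q} {P : Set p} {Q : Set q} (d : Dec P) (e : Dec Q) → (P → Q) → (Q → P) → 𝟙 d ≡ 𝟙 e
𝟙-cong d (yes q) _   Q→P = 𝟙-yes d (Q→P q)
𝟙-cong d (no ¬q) P→Q _   = 𝟙-no d (¬q ∘ P→Q)

∏-ones : ∀ {k} (f : Fin k → ℤ) → (∀ i → f i ≡ 1ℤ) → ∏ f ≡ 1ℤ
∏-ones {zero}  f h = refl
∏-ones {suc k} f h = cong₂ _*_ (h zero) (∏-ones (f ∘ suc) (h ∘ suc))

∏≡0⇔ : ∀ {k} (f : Fin k → ℤ) → ∏ f ≡ 0ℤ ⇔ ∃ λ i → f i ≡ 0ℤ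
∏≡0⇔ f = mk⇔ (to f) (λ (i , fi≡0) → from f i fi≡0)
  where
  to : ∀ {k} (f : Fin k → ℤ) → ∏ f ≡ 0ℤ → ∃ λ i → f i ≡ 0ℤ
  to {suc k} f ∏≡0 with ℤ.i*j≡0⇒i≡0∨j≡0 (f zero) ∏≡0
  ... | inj₁ f₀≡0 = zero , f₀≡0
  ... | inj₂ rest≡0 = let i , fi≡0 = to (f ∘ suc) rest≡0 in suc i , fi≡0
  from : ∀ {k} (f : Fin k → ℤ) i → f i ≡ 0ℤ → ∏ f ≡ 0ℤ
  from f zero    f₀≡0 = trans (cong (_* ∏ (f ∘ suc)) f₀≡0) (ℤ.*-zeroˡ (∏ (f ∘ suc)))
  from f (suc i) fi≡0 = trans (cong (f zero *_) (from (f ∘ suc) i fi≡0)) (ℤ.*-zeroʳ (f zero))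

𝟙-∀ : ∀ {k p} {P : Fin k → Set p} (d : Dec (∀ i → P i)) (P? : ∀ i → Dec (P i)) →
      𝟙 d ≡ ∏ (𝟙 ∘ P?)
𝟙-∀ (yes ∀P) P? = sym (∏-ones _ (λ i → 𝟙-yes (P? i) (∀P i)))
𝟙-∀ {k} {P = P} (no ¬∀P) P? =
  let i , ¬Pi = ¬∀⟶∃¬ k P P? ¬∀P in sym (Equivalence.from (∏≡0⇔ (𝟙 ∘ P?)) (i , 𝟙-no (P? i) ¬Pi))

𝟙-∀-* : ∀ {k p} {P : Fin k → Set p} (d : Dec (∀ i → P i)) (P? : ∀ i → Dec (P i)) (f : Fin k → ℤ) →
        𝟙 d * ∏ f ≡ ∏ (λ i → 𝟙 (P? i) * f i)
𝟙-∀-* d P? f = trans (cong (_* ∏ f) (𝟙-∀ d P?)) (sym (∏-distrib-* (𝟙 ∘ P?) f))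

module _ {a} {A : Set a} where

  -- Matches `sumℤ ∘ map` of `Setup`, so `ΣP Q? f` is `∑ (filter Q? Pelems) f` by definition.
  ∑ : List A → (A → ℤ) → ℤ
  ∑ xs f = foldr _+_ 0ℤ (map f xs)

  ∑-cong-∈ : ∀ xs {f g : A → ℤ} → (∀ {x} → x ∈ xs → f x ≡ g x) → ∑ xs f ≡ ∑ xs g
  ∑-cong-∈ []       _   = refl
  ∑-cong-∈ (x ∷ xs) f≡g = cong₂ _+_ (f≡g (here refl)) (∑-cong-∈ xs (f≡g ∘ there))

  ∑-cong : ∀ xs {f g : A → ℤ} → (∀ x → f x ≡ g x) → ∑ xs f ≡ ∑ xs g
  ∑-cong xs f≡g = ∑-cong-∈ xs (λ {x} _ → f≡g x)

  ∑-zero : ∀ xs {f : A → ℤ} → (∀ {x} → x ∈ xs → f x ≡ 0ℤ) → ∑ xs f ≡ 0ℤ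
  ∑-zero []       _   = refl
  ∑-zero (x ∷ xs) f≡0 = cong₂ _+_ (f≡0 (here refl)) (∑-zero xs (f≡0 ∘ there))

  ∑-filter : ∀ {p} {P : Pred A p} (P? : Decidable P) xs (f : A → ℤ) →
             ∑ (filter P? xs) f ≡ ∑ xs (λ x → 𝟙 (P? x) * f x)
  ∑-filter P? []       f = refl
  ∑-filter P? (x ∷ xs) f with P? x
  ... | yes _ = cong₂ _+_ (sym (ℤ.*-identityˡ (f x))) (∑-filter P? xs f)
  ... | no  _ = trans (∑-filter P? xs f) (sym (ℤ.+-identityˡ _))

  ∑-distrib-+ : ∀ xs (f g : A → ℤ) → ∑ xs (λ x → f x + g x) ≡ ∑ xs f + ∑ xs g
  ∑-distrib-+ []       f g = refl
  ∑-distrib-+ (x ∷ xs) f g =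
    trans (cong (_+_ (f x + g x)) (∑-distrib-+ xs f g)) (+-interchange (f x) (g x) (∑ xs f) (∑ xs g))
    where open CommSemigroupProps ℤ.+-commutativeSemigroup renaming (interchange to +-interchange)

  ∑-*ˡ : ∀ xs k (f : A → ℤ) → ∑ xs (λ x → k * f x) ≡ k * ∑ xs f
  ∑-*ˡ []       k f = sym (ℤ.*-zeroʳ k)
  ∑-*ˡ (x ∷ xs) k f = trans (cong (_+_ (k * f x)) (∑-*ˡ xs k f)) (sym (ℤ.*-distribˡ-+ k (f x) (∑ xs f)))

  ∑-*ʳ : ∀ xs k (f : A → ℤ) → ∑ xs (λ x → f x * k) ≡ ∑ xs f * k
  ∑-*ʳ xs k f = begin
    ∑ xs (λ x → f x * k) ≡⟨ ∑-cong xs (λ x → ℤ.*-comm (f x) k) ⟩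
    ∑ xs (λ x → k * f x) ≡⟨ ∑-*ˡ xs k f ⟩
    k * ∑ xs f           ≡⟨ ℤ.*-comm k (∑ xs f) ⟩
    ∑ xs f * k           ∎
    where open ≡-Reasoning

  ∑-++ : ∀ xs ys (f : A → ℤ) → ∑ (xs ++ ys) f ≡ ∑ xs f + ∑ ys f
  ∑-++ []       ys f = sym (ℤ.+-identityˡ _)
  ∑-++ (x ∷ xs) ys f = trans (cong (_+_ (f x)) (∑-++ xs ys f)) (sym (ℤ.+-assoc (f x) _ _))

  ∑-𝟙 : ∀ {p} {P : Pred A p} (P? : Decidable P) xs → ∑ xs (𝟙 ∘ P?) ≡ + length (filter P? xs)
  ∑-𝟙 P? []       = refl
  ∑-𝟙 P? (x ∷ xs) with P? x
  ... | yes _ = cong (_+_ 1ℤ) (∑-𝟙 P? xs)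
  ... | no  _ = trans (ℤ.+-identityˡ _) (∑-𝟙 P? xs)

  ∑-𝟙≡ : (_≟_ : DecidableEquality A) → ∀ {xs} → Unique xs → ∀ {y} → y ∈ xs → (f : A → ℤ) →
         ∑ xs (λ x → 𝟙 (x ≟ y) * f x) ≡ f y
  ∑-𝟙≡ _≟_ {x ∷ xs} (x∉xs ∷ _) (here refl) f = begin
    𝟙 (x ≟ x) * f x + ∑ xs (λ z → 𝟙 (z ≟ x) * f z) ≡⟨ cong₂ _+_ (cong (_* f x) (𝟙-yes (x ≟ x) refl)) rest≡0 ⟩
    1ℤ * f x + 0ℤ                                   ≡⟨ ℤ.+-identityʳ _ ⟩
    1ℤ * f x                                        ≡⟨ ℤ.*-identityˡ (f x) ⟩
    f x                                             ∎
    where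
    open ≡-Reasoning
    rest≡0 : ∑ xs (λ z → 𝟙 (z ≟ x) * f z) ≡ 0ℤ
    rest≡0 = ∑-zero xs (λ {z} z∈xs → trans (cong (_* f z) (𝟙-no (z ≟ x) (All.lookup x∉xs z∈xs ∘ sym)))
                                            (ℤ.*-zeroˡ (f z)))
  ∑-𝟙≡ _≟_ {x ∷ xs} (x∉xs ∷ xs!) {y} (there y∈xs) f = begin
    𝟙 (x ≟ y) * f x + ∑ xs (λ z → 𝟙 (z ≟ y) * f z) ≡⟨ cong₂ _+_ x-term≡0 (∑-𝟙≡ _≟_ xs! y∈xs f) ⟩
    0ℤ + f y                                        ≡⟨ ℤ.+-identityˡ (f y) ⟩
    f y                                             ∎
    where
    open ≡-Reasoning
    x-term≡0 : 𝟙 (x ≟ y) * f x ≡ 0ℤ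
    x-term≡0 = trans (cong (_* f x) (𝟙-no (x ≟ y) (All.lookup x∉xs y∈xs))) (ℤ.*-zeroˡ (f x))

module _ {a b} {A : Set a} {B : Set b} where

  ∑-map : ∀ (g : B → A) ys (f : A → ℤ) → ∑ (map g ys) f ≡ ∑ ys (f ∘ g)
  ∑-map g []       f = refl
  ∑-map g (y ∷ ys) f = cong (_+_ (f (g y))) (∑-map g ys f)

  ∑-concatMap : ∀ (g : B → List A) ys (f : A → ℤ) → ∑ (concatMap g ys) f ≡ ∑ ys (λ y → ∑ (g y) f)
  ∑-concatMap g []       f = refl
  ∑-concatMap g (y ∷ ys) f = trans (∑-++ (g y) (concatMap g ys) f) (cong (_+_ (∑ (g y) f)) (∑-concatMap g ys f))

  ∑-comm : ∀ (xs : List A) (ys : List B) (f : A → B → ℤ) →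
           ∑ xs (λ x → ∑ ys (f x)) ≡ ∑ ys (λ y → ∑ xs (λ x → f x y))
  ∑-comm []       ys f = sym (∑-zero ys (λ _ → refl))
  ∑-comm (x ∷ xs) ys f = trans (cong (_+_ (∑ ys (f x))) (∑-comm xs ys f)) (sym (∑-distrib-+ ys (f x) _))

module _ {a p q} {A : Set a} {P : Pred A p} {Q : Pred A q} (P? : Decidable P) (Q? : Decidable Q)
         (P⇒Q : ∀ {x} → P x → Q x) where

  filter-⊆ : ∀ xs → filter P? xs ⊆ filter Q? xs
  filter-⊆ xs = ⊆-filter-Sublist P? Q? (λ { refl → P⇒Q }) (⊆-refl {x = xs})

  length-filter-mono : ∀ xs → length (filter P? xs) ℕ.≤ length (filter Q? xs)
  length-filter-mono xs = length-mono-≤ (filter-⊆ xs)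

  length-filter-strictMono : ∀ {xs y} → y ∈ xs → Q y → ¬ P y → length (filter P? xs) ℕ.< length (filter Q? xs)
  length-filter-strictMono {xs} y∈xs Qy ¬Py = ℕ.≤∧≢⇒< (length-filter-mono xs) λ |P|≡|Q| →
    let filterP≡filterQ = Pointwise-≡⇒≡ (toPointwise |P|≡|Q| (filter-⊆ xs))
    in ¬Py (proj₂ (∈-filter⁻ P? {xs = xs} (subst (_ ∈_) (sym filterP≡filterQ) (∈-filter⁺ Q? y∈xs Qy))))

module _ {a p} {A : Set a} {P : Pred A p} (P? : Decidable P) where

  length-filter≡1 : ∀ xs → length (filter P? xs) ≡ 1 →
                    ∃ λ y → y ∈ xs × P y × (∀ {z} → z ∈ xs → P z → z ≡ y)
  length-filter≡1 xs |P|≡1 with filter P? xs in eq | |P|≡1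
  ... | y ∷ [] | _ = let y∈xs , Py = ∈-filter⁻ P? (subst (y ∈_) (sym eq) (here refl)) in y , y∈xs , Py , unique
    where
    unique : ∀ {z} → z ∈ xs → P z → z ≡ y
    unique z∈xs Pz with subst (_ ∈_) eq (∈-filter⁺ P? z∈xs Pz)
    ... | here z≡y = z≡y

module Rank (L : FiniteRankedLattice) where
  open FiniteRankedLattice L
  open IsLattice isLattice using (antisym) renaming (refl to ≤-refl; trans to ≤-trans)

  interval : Carrier → Carrier → ℕ
  interval w x = length (filter (λ z → (w ≤? z) ×-dec (z ≤? x)) elems)

  StrictlyBetween : Carrier → Carrier → Carrier → Set
  StrictlyBetween w x z = w ≤ z × z ≤ x × z ≢ w × z ≢ x

  ⋖-or-between : ∀ {w x} → w ≤ x → w ≢ x → w ⋖ x ⊎ ∃ (StrictlyBetween w x)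
  ⋖-or-between {w} {x} w≤x w≢x
    with any? (λ z → (w ≤? z) ×-dec (z ≤? x) ×-dec ¬? (z ≟ w) ×-dec ¬? (z ≟ x)) elems
  ... | yes ∃z = inj₂ (satisfied ∃z)
  ... | no  ∄z = inj₁ (w≤x , w≢x , covers)
    where
    covers : ∀ z → w ≤ z → z ≤ x → z ≡ w ⊎ z ≡ x
    covers z w≤z z≤x with z ≟ w | z ≟ x
    ... | yes z≡w | _       = inj₁ z≡w
    ... | no  _   | yes z≡x = inj₂ z≡x
    ... | no  z≢w | no  z≢x = contradiction (lose (elems-all z) (w≤z , z≤x , z≢w , z≢x)) ∄z

  interval-⊂ : ∀ {w x w′ x′ y} → w ≤ w′ → x′ ≤ x → w ≤ y → y ≤ x → ¬ (w′ ≤ y × y ≤ x′) →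
               interval w′ x′ ℕ.< interval w x
  interval-⊂ {w} {x} {w′} {x′} w≤w′ x′≤x w≤y y≤x y∉[w′,x′] =
    length-filter-strictMono (λ c → (w′ ≤? c) ×-dec (c ≤? x′)) (λ c → (w ≤? c) ×-dec (c ≤? x))
      (λ (w′≤c , c≤x′) → ≤-trans w≤w′ w′≤c , ≤-trans c≤x′ x′≤x) (elems-all _) (w≤y , y≤x) y∉[w′,x′]

  -- Induction on the size of the interval [w, x], which shrinks when it is split at an inner point.
  ρ-strictMono-bounded : ∀ m {w x} → interval w x ℕ.≤ m → w ≤ x → w ≢ x → ρ w ℕ.< ρ x
  ρ-strictMono-bounded zero {w} |I|≤0 w≤x _ =
    contradiction |I|≤0 (ℕ.<⇒≱ (filter-some (λ z → (w ≤? z) ×-dec (z ≤? _)) (lose (elems-all w) (≤-refl , w≤x))))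
  ρ-strictMono-bounded (suc m) {w} {x} |I|≤1+m w≤x w≢x with ⋖-or-between w≤x w≢x
  ... | inj₁ w⋖x = ℕ.≤-reflexive (sym (ρ-cover w x w⋖x))
  ... | inj₂ (z , w≤z , z≤x , z≢w , z≢x) =
    ℕ.<-trans (ρ-strictMono-bounded m (shrunk [w,z]⊂[w,x]) w≤z (z≢w ∘ sym))
              (ρ-strictMono-bounded m (shrunk [z,x]⊂[w,x]) z≤x z≢x)
    where
    shrunk : ∀ {w′ x′} → interval w′ x′ ℕ.< interval w x → interval w′ x′ ℕ.≤ m
    shrunk |I′|<|I| = ℕ.≤-pred (ℕ.<-≤-trans |I′|<|I| |I|≤1+m)
    [w,z]⊂[w,x] : interval w z ℕ.< interval w x
    [w,z]⊂[w,x] = interval-⊂ ≤-refl z≤x w≤x ≤-refl (λ (_ , x≤z) → z≢x (antisym z≤x x≤z))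
    [z,x]⊂[w,x] : interval z x ℕ.< interval w x
    [z,x]⊂[w,x] = interval-⊂ w≤z ≤-refl ≤-refl w≤x (λ (z≤w , _) → z≢w (antisym z≤w w≤z))

  ρ-strictMono : ∀ {w x} → w ≤ x → w ≢ x → ρ w ℕ.< ρ x
  ρ-strictMono {w} {x} = ρ-strictMono-bounded (interval w x) ℕ.≤-refl

  ≤∧ρ≤⇒≡ : ∀ {w x} → w ≤ x → ρ x ℕ.≤ ρ w → w ≡ x
  ≤∧ρ≤⇒≡ {w} {x} w≤x ρx≤ρw with w ≟ x
  ... | yes w≡x = w≡x
  ... | no  w≢x = contradiction (ρ-strictMono w≤x w≢x) (ℕ.≤⇒≯ ρx≤ρw)

module Transversals (L : FiniteRankedLattice) (n : ℕ) (blk : FiniteRankedLattice.Carrier L → Fin n) where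
  open Setup L n blk
  open Rank L
  open IsLattice isLattice using (x≤x∨y; y≤x∨y; ∨-least; antisym) renaming (refl to ≤-refl; trans to ≤-trans)

  ≤-bigJoin : ∀ {k} (t : Fin k → Carrier) i → t i ≤ bigJoin t
  ≤-bigJoin t zero    = x≤x∨y _ _
  ≤-bigJoin t (suc i) = ≤-trans (≤-bigJoin (t ∘ suc) i) (y≤x∨y _ _)

  bigJoin-least : ∀ {k} (t : Fin k → Carrier) {z} → (∀ i → t i ≤ z) → bigJoin t ≤ z
  bigJoin-least {zero}  t t≤z = 𝟘-min _
  bigJoin-least {suc k} t t≤z = ∨-least (t≤z zero) (bigJoin-least (t ∘ suc) (t≤z ∘ suc))

  bigJoin-cong : ∀ {k} {s t : Fin k → Carrier} → s ≗ t → bigJoin s ≡ bigJoin t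
  bigJoin-cong {zero}  s≗t = refl
  bigJoin-cong {suc k} s≗t = cong₂ _∨_ (s≗t zero) (bigJoin-cong (s≗t ∘ suc))

  ≤P⇒≤ : ∀ {s t} → s ≤P t → ∀ i → s i ≤ t i
  ≤P⇒≤ {s} {t} s≤t i with s≤t i
  ... | inj₁ si≡𝟘  = subst (_≤ t i) (sym si≡𝟘) (𝟘-min (t i))
  ... | inj₂ si≡ti = subst (_≤ t i) (sym si≡ti) ≤-refl

  ≤P⇒bigJoin-≤ : ∀ {s t} → s ≤P t → bigJoin s ≤ bigJoin t
  ≤P⇒bigJoin-≤ {s} {t} s≤t = bigJoin-least s (λ i → ≤-trans (≤P⇒≤ s≤t i) (≤-bigJoin t i))

  InClaw : Fin n → Carrier → Set
  InClaw i c = c ≡ 𝟘 ⊎ (IsAtom c × blk c ≡ i)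

  inClaw? : ∀ i c → Dec (InClaw i c)
  inClaw? i c = (c ≟ 𝟘) ⊎-dec (atom? c ×-dec (blk c Fin.≟ i))

  IsTransversal-resp-≗ : ∀ {s t} → s ≗ t → IsTransversal t → IsTransversal s
  IsTransversal-resp-≗ s≗t tP i = subst (InClaw i) (sym (s≗t i)) (tP i)

  -- `funs` and `Pelems` list each function only up to pointwise equality.
  funs-complete : ∀ k (f : Fin k → Carrier) → Any (_≗ f) (funs k)
  funs-complete zero    f = here (λ ())
  funs-complete (suc k) f =
    concatMap⁺ _ (Any.map (λ { refl → map⁺ (Any.map (head-tail-≗ refl) (funs-complete k (f ∘ suc))) })
                          (elems-all (f zero)))
    where
    head-tail-≗ : ∀ {h : Fin (suc k) → Carrier} → h zero ≡ f zero → h ∘ suc ≗ f ∘ suc → h ≗ f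
    head-tail-≗ h₀≡f₀ _     zero    = h₀≡f₀
    head-tail-≗ _     hs≗fs (suc i) = hs≗fs i

  Pelems-complete : ∀ (t : P) → Any (_≗ proj₁ t) Pelems
  Pelems-complete (t , tP) =
    let g , g∈funs , g≗t = find (funs-complete n t)
    in lose (∈-filter⁺ transversal? g∈funs (IsTransversal-resp-≗ g≗t tP)) g≗t

  Pelems-transversal : ∀ {t} → t ∈ Pelems → IsTransversal t
  Pelems-transversal = proj₂ ∘ ∈-filter⁻ transversal? {xs = funs n}

  InIdeal-intro : ∀ {x s} (t : P) → bigJoin (proj₁ t) ≡ x → s ≤P proj₁ t → InIdeal x s
  InIdeal-intro {x} {s} t ⋁t≡x s≤t = Any.map witness (Pelems-complete t)
    where
    witness : ∀ {g} → g ≗ proj₁ t → bigJoin g ≡ x × s ≤P g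
    witness g≗t = trans (bigJoin-cong g≗t) ⋁t≡x , λ i → Sum.map₂ (λ si≡ti → trans si≡ti (sym (g≗t i))) (s≤t i)

  InIdeal-elim : ∀ {x s} → InIdeal x s → Σ P λ t → bigJoin (proj₁ t) ≡ x × s ≤P proj₁ t
  InIdeal-elim ∃t = let t , t∈Pelems , ⋁t≡x , s≤t = find ∃t
                    in (t , Pelems-transversal t∈Pelems) , ⋁t≡x , s≤t

  InIdeal⇒bounded : ∀ {x s} → InIdeal x s → ∀ i → s i ≤ x
  InIdeal⇒bounded ∃t i = let (t , _) , ⋁t≡x , s≤t = InIdeal-elim ∃t
                         in ≤-trans (≤P⇒≤ s≤t i) (subst (t i ≤_) ⋁t≡x (≤-bigJoin t i))

  fill : (s t : Fin n → Carrier) → Fin n → Carrier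
  fill s t i with s i ≟ 𝟘
  ... | yes _ = t i
  ... | no  _ = s i

  fill-transversal : ∀ {s t} → IsTransversal s → IsTransversal t → IsTransversal (fill s t)
  fill-transversal {s} sP tP i with s i ≟ 𝟘
  ... | yes _ = tP i
  ... | no  _ = sP i

  ≤P-fill : ∀ s t → s ≤P fill s t
  ≤P-fill s t i with s i ≟ 𝟘
  ... | yes si≡𝟘 = inj₁ si≡𝟘
  ... | no  _    = inj₂ refl

  fill-bounded : ∀ {s t x} → (∀ i → s i ≤ x) → (∀ i → t i ≤ x) → ∀ i → fill s t i ≤ x
  fill-bounded {s} s≤x t≤x i with s i ≟ 𝟘
  ... | yes _ = t≤x i
  ... | no  _ = s≤x i

  fill-nonzero : ∀ {s t} i → t i ≢ 𝟘 → fill s t i ≢ 𝟘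
  fill-nonzero {s} i ti≢𝟘 with s i ≟ 𝟘
  ... | yes _    = ti≢𝟘
  ... | no  si≢𝟘 = si≢𝟘

  suppSize-fill : ∀ s t → suppSize t ℕ.≤ suppSize (fill s t)
  suppSize-fill s t = length-filter-mono (λ i → ¬? (t i ≟ 𝟘)) (λ i → ¬? (fill s t i ≟ 𝟘)) (fill-nonzero _) (allFin n)

  ∼𝟘P⇒≡𝟘 : ∀ (t : Fin n → Carrier) → t ∼ 𝟘P → ∀ i → t i ≡ 𝟘
  ∼𝟘P⇒≡𝟘 t ⋁t≡𝟘 i =
    antisym (≤-trans (subst (t i ≤_) ⋁t≡𝟘 (≤-bigJoin t i)) (bigJoin-least 𝟘P (λ _ → ≤-refl))) (𝟘-min (t i))

  ∑-funs-∏ : ∀ k (g : Fin k → Carrier → ℤ) → ∑ (funs k) (λ t → ∏ (λ i → g i (t i))) ≡ ∏ (λ i → ∑ elems (g i))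
  ∑-funs-∏ zero    g = refl
  ∑-funs-∏ (suc k) g = begin
    ∑ (funs (suc k)) (λ t → ∏ (λ i → g i (t i)))
      ≡⟨ trans (∑-concatMap _ elems _) (∑-cong elems (λ c → ∑-map _ (funs k) _)) ⟩
    ∑ elems (λ c → ∑ (funs k) (λ t → g zero c * ∏ (λ i → g (suc i) (t i))))
      ≡⟨ ∑-cong elems (λ c → ∑-*ˡ (funs k) (g zero c) _) ⟩
    ∑ elems (λ c → g zero c * ∑ (funs k) (λ t → ∏ (λ i → g (suc i) (t i))))
      ≡⟨ ∑-cong elems (λ c → cong (g zero c *_) (∑-funs-∏ k (g ∘ suc))) ⟩
    ∑ elems (λ c → g zero c * ∏ (λ i → ∑ elems (g (suc i))))
      ≡⟨ ∑-*ʳ elems _ (g zero) ⟩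
    ∏ (λ i → ∑ elems (g i))
      ∎
    where open ≡-Reasoning

  ∑-P-∏ : ∀ (g : Fin n → Carrier → ℤ) →
          ∑ Pelems (λ t → ∏ (λ i → g i (t i))) ≡ ∏ (λ i → ∑ elems (λ c → 𝟙 (inClaw? i c) * g i c))
  ∑-P-∏ g = begin
    ∑ Pelems (λ t → ∏ (λ i → g i (t i)))
      ≡⟨ ∑-filter transversal? (funs n) _ ⟩
    ∑ (funs n) (λ t → 𝟙 (transversal? t) * ∏ (λ i → g i (t i)))
      ≡⟨ ∑-cong (funs n) (λ t → 𝟙-∀-* (transversal? t) (λ i → inClaw? i (t i)) _) ⟩
    ∑ (funs n) (λ t → ∏ (λ i → 𝟙 (inClaw? i (t i)) * g i (t i)))
      ≡⟨ ∑-funs-∏ n _ ⟩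
    ∏ (λ i → ∑ elems (λ c → 𝟙 (inClaw? i c) * g i c))
      ∎
    where open ≡-Reasoning

  δ𝟘≡𝟙 : ∀ t → δ𝟘 t ≡ 𝟙 (all? (λ i → t i ≟ 𝟘))
  δ𝟘≡𝟙 t with all? (λ i → t i ≟ 𝟘)
  ... | yes _ = refl
  ... | no  _ = refl

  module Weighting (x : Carrier) where

    AtomBelow : Fin n → Carrier → Set
    AtomBelow i c = IsAtom c × blk c ≡ i × c ≤ x

    atomBelow? : ∀ i c → Dec (AtomBelow i c)
    atomBelow? i c = atom? c ×-dec (blk c Fin.≟ i) ×-dec (c ≤? x)

    atomCount : Fin n → ℤ
    atomCount i = ∑ elems (𝟙 ∘ atomBelow? i)

    atomCount≡1⇔ : ∀ i → atomCount i ≡ 1ℤ ⇔ OneAtomBelow i x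
    atomCount≡1⇔ i = mk⇔ to from
      where
      to : atomCount i ≡ 1ℤ → OneAtomBelow i x
      to count≡1 =
        let a , _ , a-below , unique =
              length-filter≡1 (atomBelow? i) elems (ℤ.+-injective (trans (sym (∑-𝟙 (atomBelow? i) elems)) count≡1))
        in a , a-below , λ b b-atom blk-b b≤x → unique (elems-all b) (b-atom , blk-b , b≤x)
      from : OneAtomBelow i x → atomCount i ≡ 1ℤ
      from (a , a-below , unique) = begin
        ∑ elems (𝟙 ∘ atomBelow? i)      ≡⟨ ∑-cong elems (λ c → trans (𝟙-atomBelow≡𝟙-≡a c) (sym (ℤ.*-identityʳ _))) ⟩
        ∑ elems (λ c → 𝟙 (c ≟ a) * 1ℤ)  ≡⟨ ∑-𝟙≡ _≟_ elems-uniq (elems-all a) (λ _ → 1ℤ) ⟩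
        1ℤ                              ∎
        where
        open ≡-Reasoning
        𝟙-atomBelow≡𝟙-≡a : ∀ c → 𝟙 (atomBelow? i c) ≡ 𝟙 (c ≟ a)
        𝟙-atomBelow≡𝟙-≡a c = 𝟙-cong (atomBelow? i c) (c ≟ a)
          (λ (c-atom , blk-c , c≤x) → unique c c-atom blk-c c≤x) (λ { refl → a-below })

    weight : Fin n → Carrier → ℤ
    weight i c = 1ℤ - 𝟙 (c ≟ 𝟘) * atomCount i

    Weight : (Fin n → Carrier) → ℤ
    Weight t = ∏ (λ i → 𝟙 (t i ≤? x) * weight i (t i))

    weight-𝟘 : ∀ i → weight i 𝟘 ≡ 1ℤ - atomCount i
    weight-𝟘 i = cong (1ℤ -_) (trans (cong (_* atomCount i) (𝟙-yes (𝟘 ≟ 𝟘) refl)) (ℤ.*-identityˡ (atomCount i)))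

    weight-≢𝟘 : ∀ i {c} → c ≢ 𝟘 → weight i c ≡ 1ℤ
    weight-≢𝟘 i {c} c≢𝟘 = cong (1ℤ -_) (trans (cong (_* atomCount i) (𝟙-no (c ≟ 𝟘) c≢𝟘)) (ℤ.*-zeroˡ (atomCount i)))

    𝟙-atomBelow-weight : ∀ i c → 𝟙 (atomBelow? i c) * weight i c ≡ 𝟙 (atomBelow? i c)
    𝟙-atomBelow-weight i c with atomBelow? i c
    ... | yes (c-atom , _) = trans (ℤ.*-identityˡ _) (weight-≢𝟘 i (proj₁ (proj₂ c-atom) ∘ sym))
    ... | no  _            = ℤ.*-zeroˡ (weight i c)

    𝟙-inClaw-below : ∀ i c → 𝟙 (inClaw? i c) * 𝟙 (c ≤? x) ≡ 𝟙 (c ≟ 𝟘) + 𝟙 (atomBelow? i c)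
    𝟙-inClaw-below i c with c ≟ 𝟘 | atom? c | blk c Fin.≟ i | c ≤? x
    ... | yes c≡𝟘 | yes c-atom | _     | _      = contradiction (sym c≡𝟘) (proj₁ (proj₂ c-atom))
    ... | yes c≡𝟘 | no  _      | _     | no c≰x = contradiction (subst (_≤ x) (sym c≡𝟘) (𝟘-min x)) c≰x
    ... | yes _   | no  _      | _     | yes _  = refl
    ... | no  _   | yes _      | yes _ | yes _  = refl
    ... | no  _   | yes _      | yes _ | no  _  = refl
    ... | no  _   | yes _      | no  _ | _      = refl
    ... | no  _   | no  _      | _     | _      = refl

    ∑-claw-above : ∀ i {σ} → InClaw i σ →
                   ∑ elems (λ c → 𝟙 (inClaw? i c) * (𝟙 ((σ ≟ 𝟘) ⊎-dec (σ ≟ c)) * (𝟙 (c ≤? x) * weight i c)))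
                   ≡ 𝟙 (σ ≤? x)
    ∑-claw-above i (inj₁ refl) = begin
      ∑ elems (λ c → 𝟙 (inClaw? i c) * (𝟙 ((𝟘 ≟ 𝟘) ⊎-dec (𝟘 ≟ c)) * (𝟙 (c ≤? x) * weight i c)))
        ≡⟨ ∑-cong elems summand ⟩
      ∑ elems (λ c → 𝟙 (c ≟ 𝟘) * weight i c + 𝟙 (atomBelow? i c))
        ≡⟨ ∑-distrib-+ elems _ _ ⟩
      ∑ elems (λ c → 𝟙 (c ≟ 𝟘) * weight i c) + atomCount i
        ≡⟨ cong (_+ atomCount i) (trans (∑-𝟙≡ _≟_ elems-uniq (elems-all 𝟘) (weight i)) (weight-𝟘 i)) ⟩
      1ℤ - atomCount i + atomCount i
        ≡⟨ //-rightDividesˡ (atomCount i) 1ℤ ⟩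
      1ℤ
        ≡⟨ 𝟙-yes (𝟘 ≤? x) (𝟘-min x) ⟨
      𝟙 (𝟘 ≤? x)
        ∎
      where
      open ≡-Reasoning
      open GroupProps (AbelianGroup.group ℤ.+-0-abelianGroup) using (//-rightDividesˡ)
      summand : ∀ c → 𝟙 (inClaw? i c) * (𝟙 ((𝟘 ≟ 𝟘) ⊎-dec (𝟘 ≟ c)) * (𝟙 (c ≤? x) * weight i c))
                    ≡ 𝟙 (c ≟ 𝟘) * weight i c + 𝟙 (atomBelow? i c)
      summand c = begin
        𝟙 (inClaw? i c) * (𝟙 ((𝟘 ≟ 𝟘) ⊎-dec (𝟘 ≟ c)) * (𝟙 (c ≤? x) * weight i c))
          ≡⟨ cong (λ z → 𝟙 (inClaw? i c) * (z * (𝟙 (c ≤? x) * weight i c)))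
                  (𝟙-yes ((𝟘 ≟ 𝟘) ⊎-dec (𝟘 ≟ c)) (inj₁ refl)) ⟩
        𝟙 (inClaw? i c) * (1ℤ * (𝟙 (c ≤? x) * weight i c))
          ≡⟨ cong (𝟙 (inClaw? i c) *_) (ℤ.*-identityˡ _) ⟩
        𝟙 (inClaw? i c) * (𝟙 (c ≤? x) * weight i c)
          ≡⟨ ℤ.*-assoc (𝟙 (inClaw? i c)) _ _ ⟨
        𝟙 (inClaw? i c) * 𝟙 (c ≤? x) * weight i c
          ≡⟨ cong (_* weight i c) (𝟙-inClaw-below i c) ⟩
        (𝟙 (c ≟ 𝟘) + 𝟙 (atomBelow? i c)) * weight i c
          ≡⟨ ℤ.*-distribʳ-+ (weight i c) (𝟙 (c ≟ 𝟘)) _ ⟩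
        𝟙 (c ≟ 𝟘) * weight i c + 𝟙 (atomBelow? i c) * weight i c
          ≡⟨ cong (_+_ (𝟙 (c ≟ 𝟘) * weight i c)) (𝟙-atomBelow-weight i c) ⟩
        𝟙 (c ≟ 𝟘) * weight i c + 𝟙 (atomBelow? i c)
          ∎
    ∑-claw-above i {σ} (inj₂ σ-atom-in-Aᵢ@(σ-atom , _)) = begin
      ∑ elems (λ c → 𝟙 (inClaw? i c) * (𝟙 ((σ ≟ 𝟘) ⊎-dec (σ ≟ c)) * (𝟙 (c ≤? x) * weight i c)))
        ≡⟨ ∑-cong elems (λ c → trans (cong (λ z → 𝟙 (inClaw? i c) * (z * (𝟙 (c ≤? x) * weight i c))) (σ≤c⇔c≡σ c))
                                     (x∙yz≈y∙xz (𝟙 (inClaw? i c)) (𝟙 (c ≟ σ)) _)) ⟩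
      ∑ elems (λ c → 𝟙 (c ≟ σ) * (𝟙 (inClaw? i c) * (𝟙 (c ≤? x) * weight i c)))
        ≡⟨ ∑-𝟙≡ _≟_ elems-uniq (elems-all σ) _ ⟩
      𝟙 (inClaw? i σ) * (𝟙 (σ ≤? x) * weight i σ)
        ≡⟨ cong₂ (λ a b → a * (𝟙 (σ ≤? x) * b)) (𝟙-yes (inClaw? i σ) (inj₂ σ-atom-in-Aᵢ)) (weight-≢𝟘 i σ≢𝟘) ⟩
      1ℤ * (𝟙 (σ ≤? x) * 1ℤ)
        ≡⟨ trans (ℤ.*-identityˡ _) (ℤ.*-identityʳ _) ⟩
      𝟙 (σ ≤? x)
        ∎
      where
      open ≡-Reasoning
      open CommSemigroupProps ℤ.*-commutativeSemigroup using (x∙yz≈y∙xz)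
      σ≢𝟘 : σ ≢ 𝟘
      σ≢𝟘 = proj₁ (proj₂ σ-atom) ∘ sym
      σ≤c⇔c≡σ : ∀ c → 𝟙 ((σ ≟ 𝟘) ⊎-dec (σ ≟ c)) ≡ 𝟙 (c ≟ σ)
      σ≤c⇔c≡σ c = 𝟙-cong ((σ ≟ 𝟘) ⊎-dec (σ ≟ c)) (c ≟ σ)
                          [ (λ σ≡𝟘 → contradiction σ≡𝟘 σ≢𝟘) , sym ]′ (inj₂ ∘ sym)

    ∑-Weight-above : ∀ (s : P) →
                     ∑ Pelems (λ t → 𝟙 (≤P? (proj₁ s) t) * Weight t) ≡ 𝟙 (all? (λ i → proj₁ s i ≤? x))
    ∑-Weight-above (s , sP) = begin
      ∑ Pelems (λ t → 𝟙 (≤P? s t) * Weight t)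
        ≡⟨ ∑-cong Pelems (λ t → 𝟙-∀-* (≤P? s t) (λ i → (s i ≟ 𝟘) ⊎-dec (s i ≟ t i)) _) ⟩
      ∑ Pelems (λ t → ∏ (λ i → 𝟙 ((s i ≟ 𝟘) ⊎-dec (s i ≟ t i)) * (𝟙 (t i ≤? x) * weight i (t i))))
        ≡⟨ ∑-P-∏ _ ⟩
      ∏ (λ i → ∑ elems (λ c → 𝟙 (inClaw? i c) * (𝟙 ((s i ≟ 𝟘) ⊎-dec (s i ≟ c)) * (𝟙 (c ≤? x) * weight i c))))
        ≡⟨ ∏-cong (λ i → ∑-claw-above i (sP i)) ⟩
      ∏ (λ i → 𝟙 (s i ≤? x))
        ≡⟨ 𝟙-∀ (all? (λ i → s i ≤? x)) (λ i → s i ≤? x) ⟨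
      𝟙 (all? (λ i → s i ≤? x))
        ∎
      where open ≡-Reasoning

    ∑-δ𝟘-Weight : ∑ Pelems (λ t → δ𝟘 t * Weight t) ≡ ∏ (λ i → 1ℤ - atomCount i)
    ∑-δ𝟘-Weight = begin
      ∑ Pelems (λ t → δ𝟘 t * Weight t)
        ≡⟨ ∑-cong Pelems (λ t → trans (cong (_* Weight t) (δ𝟘≡𝟙 t)) (𝟙-∀-* (all? (λ i → t i ≟ 𝟘)) (λ i → t i ≟ 𝟘) _)) ⟩
      ∑ Pelems (λ t → ∏ (λ i → 𝟙 (t i ≟ 𝟘) * (𝟙 (t i ≤? x) * weight i (t i))))
        ≡⟨ ∑-P-∏ _ ⟩
      ∏ (λ i → ∑ elems (λ c → 𝟙 (inClaw? i c) * (𝟙 (c ≟ 𝟘) * (𝟙 (c ≤? x) * weight i c))))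
        ≡⟨ ∏-cong ∑-at-𝟘 ⟩
      ∏ (λ i → 1ℤ - atomCount i)
        ∎
      where
      open ≡-Reasoning
      open CommSemigroupProps ℤ.*-commutativeSemigroup using (x∙yz≈y∙xz)
      ∑-at-𝟘 : ∀ i → ∑ elems (λ c → 𝟙 (inClaw? i c) * (𝟙 (c ≟ 𝟘) * (𝟙 (c ≤? x) * weight i c))) ≡ 1ℤ - atomCount i
      ∑-at-𝟘 i = begin
        ∑ elems (λ c → 𝟙 (inClaw? i c) * (𝟙 (c ≟ 𝟘) * (𝟙 (c ≤? x) * weight i c)))
          ≡⟨ ∑-cong elems (λ c → x∙yz≈y∙xz (𝟙 (inClaw? i c)) (𝟙 (c ≟ 𝟘)) _) ⟩
        ∑ elems (λ c → 𝟙 (c ≟ 𝟘) * (𝟙 (inClaw? i c) * (𝟙 (c ≤? x) * weight i c)))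
          ≡⟨ ∑-𝟙≡ _≟_ elems-uniq (elems-all 𝟘) _ ⟩
        𝟙 (inClaw? i 𝟘) * (𝟙 (𝟘 ≤? x) * weight i 𝟘)
          ≡⟨ cong₂ (λ a b → a * (b * weight i 𝟘)) (𝟙-yes (inClaw? i 𝟘) (inj₁ refl)) (𝟙-yes (𝟘 ≤? x) (𝟘-min x)) ⟩
        1ℤ * (1ℤ * weight i 𝟘)
          ≡⟨ trans (ℤ.*-identityˡ _) (trans (ℤ.*-identityˡ _) (weight-𝟘 i)) ⟩
        1ℤ - atomCount i
          ∎

  module _ (T-nonempty : ∀ x → Σ P λ t → bigJoin (proj₁ t) ≡ x)
           (supp-rank : ∀ x (t : P) → bigJoin (proj₁ t) ≡ x → suppSize (proj₁ t) ≡ ρ x) where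

    bounded⇒InIdeal : ∀ x (s : P) → (∀ i → proj₁ s i ≤ x) → InIdeal x (proj₁ s)
    bounded⇒InIdeal x (s , sP) s≤x with T-nonempty x
    ... | (t , tP) , ⋁t≡x = InIdeal-intro r ⋁r≡x (≤P-fill s t)
      where
      r : P
      r = fill s t , fill-transversal sP tP
      ⋁r≡x : bigJoin (fill s t) ≡ x
      ⋁r≡x = ≤∧ρ≤⇒≡ (bigJoin-least _ (fill-bounded s≤x (λ i → subst (t i ≤_) ⋁t≡x (≤-bigJoin t i)))) (begin
        ρ x                       ≡⟨ supp-rank x (t , tP) ⋁t≡x ⟨
        suppSize t                ≤⟨ suppSize-fill s t ⟩
        suppSize (fill s t)       ≡⟨ supp-rank _ r refl ⟩
        ρ (bigJoin (fill s t))    ∎)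
        where open ℕ.≤-Reasoning

    InIdeal⇔bounded : ∀ x (s : P) → InIdeal x (proj₁ s) ⇔ (∀ i → proj₁ s i ≤ x)
    InIdeal⇔bounded x s = mk⇔ InIdeal⇒bounded (bounded⇒InIdeal x s)

    ∼-homogeneous : ∀ (s t : P) →
                    (Σ P λ s′ → Σ P λ t′ → proj₁ s′ ∼ proj₁ s × proj₁ t′ ∼ proj₁ t × proj₁ s′ ≤P proj₁ t′) →
                    ∀ (s″ : P) → proj₁ s″ ∼ proj₁ s → Σ P λ t″ → proj₁ t″ ∼ proj₁ t × proj₁ s″ ≤P proj₁ t″
    ∼-homogeneous _ (t , _) ((s′ , _) , (t′ , _) , s′∼s , t′∼t , s′≤t′) (s″ , s″P) s″∼s =
      InIdeal-elim (bounded⇒InIdeal (bigJoin t) (s″ , s″P) s″≤⋁t)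
      where
      s″≤⋁t : ∀ i → s″ i ≤ bigJoin t
      s″≤⋁t i = subst (s″ i ≤_) t′∼t (≤-trans (subst (s″ i ≤_) (trans s″∼s (sym s′∼s)) (≤-bigJoin s″ i))
                                              (≤P⇒bigJoin-≤ s′≤t′))

    module _ (x : Carrier) (μ : (Fin n → Carrier) → ℤ) (μ-Möbius : IsMobius μ) where
      open Weighting x

      ∑-ideal-μ : ΣP (InIdeal? x) μ ≡ ∏ (λ i → 1ℤ - atomCount i)
      ∑-ideal-μ = begin
        ΣP (InIdeal? x) μ
          ≡⟨ ∑-filter (InIdeal? x) Pelems μ ⟩
        ∑ Pelems (λ s → 𝟙 (InIdeal? x s) * μ s)
          ≡⟨ ∑-cong-∈ Pelems (λ {s} s∈P → cong (_* μ s) (𝟙-ideal≡∑-Weight-above (s , Pelems-transversal s∈P))) ⟩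
        ∑ Pelems (λ s → ∑ Pelems (λ t → 𝟙 (≤P? s t) * Weight t) * μ s)
          ≡⟨ ∑-cong Pelems (λ s → trans (∑-cong Pelems (λ t → xy∙z≈xz∙y (𝟙 (≤P? s t)) (μ s) (Weight t)))
                                        (∑-*ʳ Pelems (μ s) _)) ⟨
        ∑ Pelems (λ s → ∑ Pelems (λ t → 𝟙 (≤P? s t) * μ s * Weight t))
          ≡⟨ ∑-comm Pelems Pelems _ ⟩
        ∑ Pelems (λ t → ∑ Pelems (λ s → 𝟙 (≤P? s t) * μ s * Weight t))
          ≡⟨ ∑-cong Pelems (λ t → ∑-*ʳ Pelems (Weight t) _) ⟩
        ∑ Pelems (λ t → ∑ Pelems (λ s → 𝟙 (≤P? s t) * μ s) * Weight t)
          ≡⟨ ∑-cong-∈ Pelems (λ {t} t∈P → cong (_* Weight t)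
               (trans (sym (∑-filter (λ s → ≤P? s t) Pelems μ)) (μ-Möbius (t , Pelems-transversal t∈P)))) ⟩
        ∑ Pelems (λ t → δ𝟘 t * Weight t)
          ≡⟨ ∑-δ𝟘-Weight ⟩
        ∏ (λ i → 1ℤ - atomCount i)
          ∎
        where
        open ≡-Reasoning
        open CommSemigroupProps ℤ.*-commutativeSemigroup using (xy∙z≈xz∙y)
        𝟙-ideal≡∑-Weight-above : ∀ (s : P) →
                                 𝟙 (InIdeal? x (proj₁ s)) ≡ ∑ Pelems (λ t → 𝟙 (≤P? (proj₁ s) t) * Weight t)
        𝟙-ideal≡∑-Weight-above s =
          trans (𝟙-cong (InIdeal? x (proj₁ s)) (all? (λ i → proj₁ s i ≤? x))
                        (Equivalence.to (InIdeal⇔bounded x s)) (Equivalence.from (InIdeal⇔bounded x s)))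
                (sym (∑-Weight-above s))

      ∑-ideal-μ≡0⇔ : ΣP (InIdeal? x) μ ≡ 0ℤ ⇔ ∃ λ i → OneAtomBelow i x
      ∑-ideal-μ≡0⇔ = mk⇔
        (λ ∑≡0 → let i , 1-k≡0 = Equivalence.to (∏≡0⇔ _) (trans (sym ∑-ideal-μ) ∑≡0)
                 in i , Equivalence.to (atomCount≡1⇔ i) (sym (ℤ.i-j≡0⇒i≡j 1ℤ (atomCount i) 1-k≡0)))
        (λ (i , one) → trans ∑-ideal-μ
          (Equivalence.from (∏≡0⇔ _) (i , ℤ.i≡j⇒i-j≡0 (sym (Equivalence.from (atomCount≡1⇔ i) one)))))

lemma3p2 : (L : FiniteRankedLattice) (n : ℕ) (blk : FiniteRankedLattice.Carrier L → Fin n) →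
  let open Setup L n blk in
  IsOrderedPartition →
  (∀ x → Σ P λ t → bigJoin (proj₁ t) ≡ x) →
  (∀ x (t : P) → bigJoin (proj₁ t) ≡ x → suppSize (proj₁ t) ≡ ρ x) →
  ((∀ x (s : P) → InIdeal x (proj₁ s) ⇔ (∀ i → proj₁ s i ≤ x))
   × ((∀ (t : P) → proj₁ t ∼ 𝟘P → ∀ i → proj₁ t i ≡ 𝟘)
      × (∀ (s t : P) →
           (Σ P λ s′ → Σ P λ t′ → proj₁ s′ ∼ proj₁ s × proj₁ t′ ∼ proj₁ t × proj₁ s′ ≤P proj₁ t′) →
           ∀ (s″ : P) → proj₁ s″ ∼ proj₁ s →
           Σ P λ t″ → proj₁ t″ ∼ proj₁ t × proj₁ s″ ≤P proj₁ t″))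
   × (∀ (μ : (Fin n → Carrier) → ℤ) → IsMobius μ →
        ((∀ x → x ≢ 𝟘 → ΣP (InIdeal? x) μ ≡ 0ℤ)
         ⇔ (∀ x → x ≢ 𝟘 → Σ (Fin n) λ i → OneAtomBelow i x))))
lemma3p2 L n blk _ T-nonempty supp-rank =
    InIdeal⇔bounded T-nonempty supp-rank
  , ( (λ (t , _) → ∼𝟘P⇒≡𝟘 t)
    , ∼-homogeneous T-nonempty supp-rank )
  , λ μ μ-Möbius →
      let ∑≡0⇔ x = ∑-ideal-μ≡0⇔ T-nonempty supp-rank x μ μ-Möbius in
      mk⇔ (λ ∑≡0 x x≢𝟘 → Equivalence.to (∑≡0⇔ x) (∑≡0 x x≢𝟘))
          (λ one x x≢𝟘 → Equivalence.from (∑≡0⇔ x) (one x x≢𝟘))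
  where open Transversals L n blk
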